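{- Let $\mathcal{F}$ be a finite forest and let $\vec\lambda: V(\mathcal{F})\to \mathbb{Z}_{\geq 0}$ be a labelling of its vertices. Then the bounded degree complex $\mathrm{BD}^{\vec\lambda}(\mathcal{F})$ is vertex decomposable.
   Context: For a finite simple graph $G$ and $\vec\lambda: V(G)\to\mathbb{Z}_{\ge 0}$, the bounded degree complex $\mathrm{BD}^{\vec\lambda}(G)$ is the simplicial complex whose vertex set is $E(G)$ and whose faces are the subsets $\sigma\subseteq E(G)$ such that for every $v\in V(G)$, the number of edges of $\sigma$ incident to $v$ (the degree of $v$ in the subgraph with edge set $\sigma$) is at most $\vec\lambda(v)$. For a simplicial complex $K$ and a vertex $v$, $\mathrm{lk}(v,K)=\{\tau\in K: v\notin\tau,\ \tau\cup\{v\}\in K\}$ and $\mathrm{del}(v,K)=\{\tau\in K: v\notin \tau\}$. A simplicial complex $K$ is vertex decomposable if $K$ is a simplex, or $K$ has a vertex $v$ such that (i) both $\mathrm{lk}(v,K)$ and $\mathrm{del}(v,K)$ are vertex decomposable, and (ii) every facet (maximal face) of $\mathrm{del}(v,K)$ is a facet of $K$. -}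

module Defs where

open import Data.Nat using (ℕ; _≤_)
open import Data.Fin using (Fin; _<_; _≟_)
open import Data.Fin.Subset using (Subset; _∈_; _∉_; _⊆_; ⁅_⁆; _∪_; _∩_; ∣_∣)
open import Data.Vec using (tabulate)
open import Data.Bool using (_∨_)
open import Data.List using (List; []; _∷_)
open import Data.List.Relation.Unary.Unique.Propositional using (Unique)
open import Data.Product using (Σ; _×_; _,_; proj₁; proj₂)
open import Data.Sum using (_⊎_)
open import Relation.Nullary.Decidable using (⌊_⌋)
open import Relation.Binary.PropositionalEquality using (_≡_)
open import Function.Bundles using (_⇔_)
open import Function.Definitions using (Injective)

Complex : ℕ → Set₁
Complex m = Subset m → Set

IsVertex : ∀ {m} → Complex m → Fin m → Set
IsVertex K v = K ⁅ v ⁆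

lk : ∀ {m} → Fin m → Complex m → Complex m
lk v K τ = v ∉ τ × K (τ ∪ ⁅ v ⁆)

del : ∀ {m} → Fin m → Complex m → Complex m
del v K τ = v ∉ τ × K τ

IsFacet : ∀ {m} → Complex m → Subset m → Set
IsFacet K σ = K σ × (∀ τ → K τ → σ ⊆ τ → τ ⊆ σ)

IsSimplex : ∀ {m} → Complex m → Set
IsSimplex K = Σ (Subset _) λ τ → ∀ σ → K σ ⇔ (σ ⊆ τ)

data VertexDecomposable {m} : Complex m → Set₁ where
  simplex : ∀ {K} → IsSimplex K → VertexDecomposable K
  shed    : ∀ {K} (v : Fin m) → IsVertex K v →
            VertexDecomposable (lk v K) →
            VertexDecomposable (del v K) →
            (∀ σ → IsFacet (del v K) σ → IsFacet K σ) →
            VertexDecomposable K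

-- Finite simple graphs on vertex set Fin n with m edges, edges indexed
-- by Fin m; edge e has endpoints a < b (no loops), and distinct
-- indices give distinct edges (no multiple edges).

record SimpleGraph (n m : ℕ) : Set where
  field
    ends     : Fin m → Fin n × Fin n
    ordered  : ∀ e → proj₁ (ends e) < proj₂ (ends e)
    injEnds  : Injective _≡_ _≡_ ends
open SimpleGraph public

Joins : ∀ {n m} → SimpleGraph n m → Fin m → Fin n → Fin n → Set
Joins G e u x = ends G e ≡ (u , x) ⊎ ends G e ≡ (x , u)

data Walk {n m} (G : SimpleGraph n m) : Fin n → Fin n → List (Fin m) → Set where
  nil  : ∀ {u} → Walk G u u []
  cons : ∀ {u x w e es} → Joins G e u x → Walk G x w es → Walk G u w (e ∷ es)

-- forest: no nonempty closed trail (equivalently, no cycle)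
IsForest : ∀ {n m} → SimpleGraph n m → Set
IsForest G = ∀ u es → Walk G u u es → Unique es → es ≡ []

incident : ∀ {n m} → SimpleGraph n m → Fin n → Subset m
incident G v = tabulate λ e → ⌊ v ≟ proj₁ (ends G e) ⌋ ∨ ⌊ v ≟ proj₂ (ends G e) ⌋

degree : ∀ {n m} → SimpleGraph n m → Subset m → Fin n → ℕ
degree G σ v = ∣ σ ∩ incident G v ∣

BD : ∀ {n m} → SimpleGraph n m → (Fin n → ℕ) → Complex m
BD G lam σ = ∀ v → degree G σ v ≤ lam v

-- Induction on a set A of free edges, with a set B of edges already fixed (BDWithin A B).
-- An edge that does not fit even on its own never occurs in a face and is deleted. Otherwise
-- the forest A has a vertex w all of whose A-edges, except possibly one stem g, are pendant
-- (end at a leaf of A). If all of A ∪ B fits at w, a pendant edge at w is a cone apex, since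
-- adding it changes degrees only at w and at its leaf. If not, g is a shedding vertex: its
-- link fixes g, its deletion forgets g, and a facet of the deletion saturates w (a missing
-- pendant edge could be added), so it cannot be extended by g.

module Submission where

open import Defs
open import Data.Bool using (Bool; _∨_)
open import Data.Bool.Properties using (T-∨; T-≡)
open import Data.Empty using (⊥-elim)
open import Data.Fin using (Fin; _≟_)
open import Data.Fin.Properties using (any?; all?)
open import Data.Fin.Subset
  using (Subset; inside; outside; _∈_; _∉_; _⊆_; ⁅_⁆; _∪_; _∩_; _⊂_; ∣_∣; _-_; _─_; ⊤; ⊥; Nonempty)
open import Data.Fin.Subset.Properties
open import Data.List using (List; []; _∷_; _++_; [_])
open import Data.List.Properties using (++-conicalʳ)
open import Data.List.Membership.Propositional using () renaming (_∈_ to _∈ₗ_; _∉_ to _∉ₗ_)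
open import Data.List.Membership.Propositional.Properties using (∈-++⁻)
open import Data.List.Relation.Binary.Subset.Propositional using () renaming (_⊆_ to _⊆ₗ_)
import Data.List.Relation.Unary.All as All
import Data.List.Relation.Unary.AllPairs as AllPairs
import Data.List.Relation.Unary.Any as Any
open import Data.List.Relation.Unary.Unique.Propositional using (Unique)
open import Data.List.Relation.Unary.Unique.Propositional.Properties using (++⁺)
open import Data.Nat using (ℕ; zero; suc; _+_; _≤_; _<_; _≤?_; z≤n; s≤s)
import Data.Nat.Properties as ℕP
open import Data.Product using (∃; _×_; _,_; proj₁; proj₂)
open import Data.Sum as Sum using (_⊎_; inj₁; inj₂; [_,_]′)
open import Data.Vec using ([]; _∷_; here; there)
open import Data.Vec.Properties using ([]=⇒lookup; lookup⇒[]=; lookup∘tabulate)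
open import Function using (_∘_)
open import Function.Bundles using (_⇔_; mk⇔; Equivalence)
open import Function.Construct.Composition using (_⇔-∘_)
open import Function.Construct.Symmetry using (⇔-sym)
open import Relation.Binary.PropositionalEquality
  using (_≡_; _≢_; refl; sym; trans; subst; cong; module ≡-Reasoning)
open import Relation.Nullary using (¬_; Dec; yes; no; contradiction)
open import Relation.Nullary.Decidable
  using (_×-dec_; _⊎-dec_; _→-dec_; ¬?; ⌊_⌋; toWitness; fromWitness; decidable-stable)
open import Relation.Unary using (Decidable)

open Equivalence using (to; from)

x∈p─q⇒x∉q : ∀ {k} {x : Fin k} (p q : Subset k) → x ∈ p ─ q → x ∉ q
x∈p─q⇒x∉q (_ ∷ p) (inside  ∷ q) () here
x∈p─q⇒x∉q (_ ∷ p) (outside ∷ q) here ()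
x∈p─q⇒x∉q (_ ∷ p) (_       ∷ q) (there x∈p─q) (there x∈q) = x∈p─q⇒x∉q p q x∈p─q x∈q

module _ {m : ℕ} where

  ∪-least : {p q r : Subset m} → p ⊆ r → q ⊆ r → p ∪ q ⊆ r
  ∪-least {p} {q} p⊆r q⊆r x∈p∪q = [ p⊆r , q⊆r ]′ (x∈p∪q⁻ p q x∈p∪q)

  ∪-monoˡ-⊆ : {p q : Subset m} (r : Subset m) → p ⊆ q → p ∪ r ⊆ q ∪ r
  ∪-monoˡ-⊆ {q = q} r p⊆q = ∪-least (p⊆p∪q r ∘ p⊆q) (q⊆p∪q q r)

  x∈p⇒⁅x⁆⊆p : {x : Fin m} {p : Subset m} → x ∈ p → ⁅ x ⁆ ⊆ p
  x∈p⇒⁅x⁆⊆p x∈p y∈⁅x⁆ = subst (_∈ _) (sym (x∈⁅y⁆⇒x≡y _ y∈⁅x⁆)) x∈p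

  x∉p∪q : {x : Fin m} {p q : Subset m} → x ∉ p → x ∉ q → x ∉ p ∪ q
  x∉p∪q {p = p} {q} x∉p x∉q x∈p∪q = [ x∉p , x∉q ]′ (x∈p∪q⁻ p q x∈p∪q)

  x∈p-y⇒x∈p : {x y : Fin m} {p : Subset m} → x ∈ p - y → x ∈ p
  x∈p-y⇒x∈p {y = y} {p} = p─q⊆p p ⁅ y ⁆

  x∈p-y⇒x≢y : {x y : Fin m} {p : Subset m} → x ∈ p - y → x ≢ y
  x∈p-y⇒x≢y {y = y} {p} x∈p-y = x∉⁅y⁆⇒x≢y (x∈p─q⇒x∉q p ⁅ y ⁆ x∈p-y)

  x∉p-x : {x : Fin m} {p : Subset m} → x ∉ p - x
  x∉p-x x∈p-x = x∈p-y⇒x≢y x∈p-x refl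

  p⊆p-x∪⁅x⁆ : {x : Fin m} {p : Subset m} → p ⊆ (p - x) ∪ ⁅ x ⁆
  p⊆p-x∪⁅x⁆ {x} {p} {y} y∈p with y ≟ x
  ... | yes refl = q⊆p∪q (p - x) ⁅ x ⁆ (x∈⁅x⁆ x)
  ... | no y≢x   = p⊆p∪q ⁅ x ⁆ (x∈p∧x≢y⇒x∈p-y y∈p y≢x)

  p⊆q∧x∉p⇒p⊆q-x : {x : Fin m} {p q : Subset m} → p ⊆ q → x ∉ p → p ⊆ q - x
  p⊆q∧x∉p⇒p⊆q-x p⊆q x∉p y∈p = x∈p∧x≢y⇒x∈p-y (p⊆q y∈p) λ { refl → x∉p y∈p }

  ∪-swapʳ : (p q r : Subset m) → (p ∪ q) ∪ r ≡ (p ∪ r) ∪ q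
  ∪-swapʳ p q r = begin
    (p ∪ q) ∪ r  ≡⟨ ∪-assoc p q r ⟩
    p ∪ (q ∪ r)  ≡⟨ cong (p ∪_) (∪-comm q r) ⟩
    p ∪ (r ∪ q)  ≡⟨ sym (∪-assoc p r q) ⟩
    (p ∪ r) ∪ q  ∎
    where open ≡-Reasoning

  p⊆q⇒p-x⊆q-x : {x : Fin m} {p q : Subset m} → p ⊆ q → p - x ⊆ q - x
  p⊆q⇒p-x⊆q-x p⊆q y∈p-x = x∈p∧x≢y⇒x∈p-y (p⊆q (x∈p-y⇒x∈p y∈p-x)) (x∈p-y⇒x≢y y∈p-x)

  p-x⊆q⇒p⊆q∪⁅x⁆ : {x : Fin m} {p q : Subset m} → p - x ⊆ q → p ⊆ q ∪ ⁅ x ⁆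
  p-x⊆q⇒p⊆q∪⁅x⁆ p-x⊆q = ⊆-trans p⊆p-x∪⁅x⁆ (∪-monoˡ-⊆ _ p-x⊆q)

∣p∪q∣≤∣p∣+∣q∣ : ∀ {k} (p q : Subset k) → ∣ p ∪ q ∣ ≤ ∣ p ∣ + ∣ q ∣
∣p∪q∣≤∣p∣+∣q∣ []            []            = z≤n
∣p∪q∣≤∣p∣+∣q∣ (inside  ∷ p) (inside  ∷ q) =
  s≤s (ℕP.≤-trans (∣p∪q∣≤∣p∣+∣q∣ p q) (ℕP.+-monoʳ-≤ ∣ p ∣ (ℕP.n≤1+n _)))
∣p∪q∣≤∣p∣+∣q∣ (inside  ∷ p) (outside ∷ q) = s≤s (∣p∪q∣≤∣p∣+∣q∣ p q)
∣p∪q∣≤∣p∣+∣q∣ (outside ∷ p) (inside  ∷ q) =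
  ℕP.≤-trans (s≤s (∣p∪q∣≤∣p∣+∣q∣ p q)) (ℕP.≤-reflexive (sym (ℕP.+-suc ∣ p ∣ ∣ q ∣)))
∣p∪q∣≤∣p∣+∣q∣ (outside ∷ p) (outside ∷ q) = ∣p∪q∣≤∣p∣+∣q∣ p q

module _ {m : ℕ} where

  infix 4 _≃_

  _≃_ : Complex m → Complex m → Set
  K ≃ L = ∀ σ → K σ ⇔ L σ

  ≃-sym : {K L : Complex m} → K ≃ L → L ≃ K
  ≃-sym K≃L σ = ⇔-sym (K≃L σ)

  ≃-trans : {K L M : Complex m} → K ≃ L → L ≃ M → K ≃ M
  ≃-trans K≃L L≃M σ = L≃M σ ⇔-∘ K≃L σ

  lk-resp-≃ : {K L : Complex m} (v : Fin m) → K ≃ L → lk v K ≃ lk v L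
  lk-resp-≃ v K≃L σ = mk⇔ (λ (v∉σ , Kσ∪v) → v∉σ , to (K≃L _) Kσ∪v) (λ (v∉σ , Lσ∪v) → v∉σ , from (K≃L _) Lσ∪v)

  del-resp-≃ : {K L : Complex m} (v : Fin m) → K ≃ L → del v K ≃ del v L
  del-resp-≃ v K≃L σ = mk⇔ (λ (v∉σ , Kσ) → v∉σ , to (K≃L σ) Kσ) (λ (v∉σ , Lσ) → v∉σ , from (K≃L σ) Lσ)

  IsFacet-resp-≃ : {K L : Complex m} → K ≃ L → {σ : Subset m} → IsFacet K σ → IsFacet L σ
  IsFacet-resp-≃ K≃L (Kσ , maximal) = to (K≃L _) Kσ , λ τ Lτ → maximal τ (from (K≃L τ) Lτ)

  VertexDecomposable-resp-≃ : {K L : Complex m} → K ≃ L → VertexDecomposable K → VertexDecomposable L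
  VertexDecomposable-resp-≃ K≃L (simplex (τ , K⇔⊆τ)) = simplex (τ , λ σ → K⇔⊆τ σ ⇔-∘ ⇔-sym (K≃L σ))
  VertexDecomposable-resp-≃ K≃L (shed v Kv lkK delK shedding) =
    shed v (to (K≃L _) Kv)
      (VertexDecomposable-resp-≃ (lk-resp-≃ v K≃L) lkK)
      (VertexDecomposable-resp-≃ (del-resp-≃ v K≃L) delK)
      (λ σ → IsFacet-resp-≃ K≃L ∘ shedding σ ∘ IsFacet-resp-≃ (≃-sym (del-resp-≃ v K≃L)))

  lk-del-comm : {K : Complex m} {v e : Fin m} → e ≢ v → lk v (del e K) ≃ del e (lk v K)
  lk-del-comm {e = e} e≢v σ =
    mk⇔ (λ (v∉σ , e∉σ∪v , Kσ∪v) → (e∉σ∪v ∘ p⊆p∪q _) , v∉σ , Kσ∪v)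
        (λ (e∉σ , v∉σ , Kσ∪v) → v∉σ , x∉p∪q e∉σ (x≢y⇒x∉⁅y⁆ e≢v) , Kσ∪v)

  del-del-comm : {K : Complex m} {v e : Fin m} → del v (del e K) ≃ del e (del v K)
  del-del-comm σ = mk⇔ (λ (v∉σ , e∉σ , Kσ) → e∉σ , v∉σ , Kσ) (λ (e∉σ , v∉σ , Kσ) → v∉σ , e∉σ , Kσ)

  DownClosed : Complex m → Set
  DownClosed K = ∀ {σ τ} → τ ⊆ σ → K σ → K τ

  nonVertex-del : {K : Complex m} {e : Fin m} → DownClosed K → ¬ K ⁅ e ⁆ → K ≃ del e K
  nonVertex-del down ¬Ke σ = mk⇔ (λ Kσ → (λ e∈σ → ¬Ke (down (x∈p⇒⁅x⁆⊆p e∈σ) Kσ)) , Kσ) proj₂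

  IsConeApex : Fin m → Complex m → Set
  IsConeApex e K = ∀ {σ} → K σ → K (σ ∪ ⁅ e ⁆)

  lk-downClosed : {K : Complex m} (v : Fin m) → DownClosed K → DownClosed (lk v K)
  lk-downClosed v down τ⊆σ (v∉σ , Kσ∪v) = v∉σ ∘ τ⊆σ , down (∪-monoˡ-⊆ ⁅ v ⁆ τ⊆σ) Kσ∪v

  del-downClosed : {K : Complex m} (v : Fin m) → DownClosed K → DownClosed (del v K)
  del-downClosed v down τ⊆σ (v∉σ , Kσ) = v∉σ ∘ τ⊆σ , down τ⊆σ Kσ

  lk-coneApex : {K : Complex m} {e v : Fin m} → e ≢ v → DownClosed K → IsConeApex e K → IsConeApex e (lk v K)
  lk-coneApex {e = e} {v} e≢v down apex {σ} (v∉σ , Kσ∪v) =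
    x∉p∪q v∉σ (x≢y⇒x∉⁅y⁆ (e≢v ∘ sym)) , down swap (apex Kσ∪v)
    where
    swap : (σ ∪ ⁅ e ⁆) ∪ ⁅ v ⁆ ⊆ (σ ∪ ⁅ v ⁆) ∪ ⁅ e ⁆
    swap = ∪-least (∪-monoˡ-⊆ ⁅ e ⁆ (p⊆p∪q ⁅ v ⁆)) (p⊆p∪q ⁅ e ⁆ ∘ q⊆p∪q σ ⁅ v ⁆)

  del-coneApex : {K : Complex m} {e v : Fin m} → e ≢ v → IsConeApex e K → IsConeApex e (del v K)
  del-coneApex e≢v apex (v∉σ , Kσ) = x∉p∪q v∉σ (x≢y⇒x∉⁅y⁆ (e≢v ∘ sym)) , apex Kσ

  module _ {K : Complex m} {e : Fin m} (down : DownClosed K) (apex : IsConeApex e K) where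

    cone-facet⁻ : {σ : Subset m} → IsFacet K σ → e ∈ σ × IsFacet (del e K) (σ - e)
    cone-facet⁻ {σ} (Kσ , maximal) = e∈σ , (x∉p-x , down (p─q⊆p σ _) Kσ) , maximal-e
      where
      e∈σ : e ∈ σ
      e∈σ = maximal _ (apex Kσ) (p⊆p∪q _) (q⊆p∪q σ _ (x∈⁅x⁆ e))
      maximal-e : ∀ τ → del e K τ → σ - e ⊆ τ → τ ⊆ σ - e
      maximal-e τ (e∉τ , Kτ) σ-e⊆τ x∈τ =
        x∈p∧x≢y⇒x∈p-y (maximal _ (apex Kτ) (p-x⊆q⇒p⊆q∪⁅x⁆ σ-e⊆τ) (p⊆p∪q _ x∈τ))
                      (λ { refl → e∉τ x∈τ })

    cone-facet⁺ : {σ : Subset m} → e ∈ σ → IsFacet (del e K) (σ - e) → IsFacet K σ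
    cone-facet⁺ {σ} e∈σ ((_ , Kσ-e) , maximal) = down p⊆p-x∪⁅x⁆ (apex Kσ-e) , maximal-K
      where
      maximal-K : ∀ τ → K τ → σ ⊆ τ → τ ⊆ σ
      maximal-K τ Kτ σ⊆τ {x} x∈τ with x ≟ e
      ... | yes refl = e∈σ
      ... | no x≢e   = x∈p-y⇒x∈p (maximal (τ - e) (x∉p-x , down (p─q⊆p τ _) Kτ) (p⊆q⇒p-x⊆q-x σ⊆τ)
                                          (x∈p∧x≢y⇒x∈p-y x∈τ x≢e))

  -- The apex lies in every facet, so shedding vertices of del e K stay shedding vertices of K.
  cone-vertexDecomposable : {K L : Complex m} {e : Fin m} → DownClosed K → IsConeApex e K →
                            L ≃ del e K → VertexDecomposable L → VertexDecomposable K
  cone-vertexDecomposable {K} {e = e} down apex L≃ (simplex (τ , L⇔⊆τ)) = simplex (τ ∪ ⁅ e ⁆ , K⇔)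
    where
    K⇔ : ∀ σ → K σ ⇔ (σ ⊆ τ ∪ ⁅ e ⁆)
    K⇔ σ = mk⇔ {B = σ ⊆ τ ∪ ⁅ e ⁆}
               (λ Kσ → p-x⊆q⇒p⊆q∪⁅x⁆ (to (L⇔⊆τ _) (from (L≃ _) (x∉p-x , down (p─q⊆p σ _) Kσ))))
               (λ σ⊆ → down σ⊆ (apex (proj₂ (to (L≃ τ) (from (L⇔⊆τ τ) ⊆-refl)))))
  cone-vertexDecomposable {K} {L} {e} down apex L≃ (shed v Lv lkL delL shedding) =
    shed v (proj₂ del-e-Kv)
      (cone-vertexDecomposable (lk-downClosed {K = K} v down) (lk-coneApex {K = K} e≢v down apex)
        (≃-trans (lk-resp-≃ v L≃) (lk-del-comm {K = K} e≢v)) lkL)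
      (cone-vertexDecomposable (del-downClosed {K = K} v down) (del-coneApex {K = K} e≢v apex) delL≃ delL)
      shedding-K
    where
    del-e-Kv : del e K ⁅ v ⁆
    del-e-Kv = to (L≃ _) Lv
    e≢v : e ≢ v
    e≢v = x∉⁅y⁆⇒x≢y (proj₁ del-e-Kv)
    delL≃ : del v L ≃ del e (del v K)
    delL≃ = ≃-trans (del-resp-≃ v L≃) del-del-comm
    shedding-K : ∀ σ → IsFacet (del v K) σ → IsFacet K σ
    shedding-K σ facet =
      let e∈σ , facet-e = cone-facet⁻ (del-downClosed {K = K} v down) (del-coneApex {K = K} e≢v apex) facet
      in cone-facet⁺ down apex e∈σ
           (IsFacet-resp-≃ L≃ (shedding (σ - e) (IsFacet-resp-≃ (≃-sym delL≃) facet-e)))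

module _ {n m : ℕ} (F : SimpleGraph n m) where

  Incident : Fin m → Fin n → Set
  Incident e v = v ≡ proj₁ (ends F e) ⊎ v ≡ proj₂ (ends F e)

  incident? : ∀ e v → Dec (Incident e v)
  incident? e v = (v ≟ proj₁ (ends F e)) ⊎-dec (v ≟ proj₂ (ends F e))

  ∈-incident⇔ : {e : Fin m} {v : Fin n} → e ∈ incident F v ⇔ Incident e v
  ∈-incident⇔ {e} {v} = mk⇔
    (λ e∈ → Sum.map (toWitness {a? = v ≟ _}) (toWitness {a? = v ≟ _})
                    (to T-∨ (from T-≡ (trans (sym (lookup∘tabulate isEnd e)) ([]=⇒lookup e∈)))))
    (λ e-at-v → lookup⇒[]= e _ (trans (lookup∘tabulate isEnd e)
                    (to T-≡ (from T-∨ (Sum.map (fromWitness {a? = v ≟ _}) (fromWitness {a? = v ≟ _}) e-at-v)))))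
    where
    isEnd : Fin m → Bool
    isEnd e = ⌊ v ≟ proj₁ (ends F e) ⌋ ∨ ⌊ v ≟ proj₂ (ends F e) ⌋

  joins⇒incidentˡ : ∀ {e u x} → Joins F e u x → Incident e u
  joins⇒incidentˡ (inj₁ eq) = inj₁ (sym (cong proj₁ eq))
  joins⇒incidentˡ (inj₂ eq) = inj₂ (sym (cong proj₂ eq))

  joins⇒incidentʳ : ∀ {e u x} → Joins F e u x → Incident e x
  joins⇒incidentʳ (inj₁ eq) = inj₂ (sym (cong proj₂ eq))
  joins⇒incidentʳ (inj₂ eq) = inj₁ (sym (cong proj₁ eq))

  incident⇒joins : ∀ {e v} → Incident e v → ∃ λ x → Joins F e v x
  incident⇒joins {e} (inj₁ refl) = proj₂ (ends F e) , inj₁ refl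
  incident⇒joins {e} (inj₂ refl) = proj₁ (ends F e) , inj₂ refl

  joins-incident : ∀ {e u x v} → Joins F e u x → Incident e v → v ≡ u ⊎ v ≡ x
  joins-incident (inj₁ eq) (inj₁ v≡) = inj₁ (trans v≡ (cong proj₁ eq))
  joins-incident (inj₁ eq) (inj₂ v≡) = inj₂ (trans v≡ (cong proj₂ eq))
  joins-incident (inj₂ eq) (inj₁ v≡) = inj₂ (trans v≡ (cong proj₁ eq))
  joins-incident (inj₂ eq) (inj₂ v≡) = inj₁ (trans v≡ (cong proj₂ eq))

  degree-mono-at : ∀ {X Y v} → (∀ {x} → x ∈ X → Incident x v → x ∈ Y) → degree F X v ≤ degree F Y v
  degree-mono-at {X} f = p⊆q⇒∣p∣≤∣q∣ λ x∈ →
    let x∈X , x∈I = x∈p∩q⁻ X _ x∈ in x∈p∩q⁺ (f x∈X (to ∈-incident⇔ x∈I) , x∈I)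

  degree-mono : ∀ {X Y} → X ⊆ Y → ∀ v → degree F X v ≤ degree F Y v
  degree-mono X⊆Y v = degree-mono-at {v = v} (λ x∈X _ → X⊆Y x∈X)

  degree-∪⁅⁆ : ∀ X h v → degree F (X ∪ ⁅ h ⁆) v ≤ suc (degree F X v)
  degree-∪⁅⁆ X h v = begin
    degree F (X ∪ ⁅ h ⁆) v      ≤⟨ p⊆q⇒∣p∣≤∣q∣ split ⟩
    ∣ (X ∩ I) ∪ ⁅ h ⁆ ∣         ≤⟨ ∣p∪q∣≤∣p∣+∣q∣ (X ∩ I) ⁅ h ⁆ ⟩
    degree F X v + ∣ ⁅ h ⁆ ∣    ≡⟨ cong (degree F X v +_) (∣⁅x⁆∣≡1 h) ⟩
    degree F X v + 1            ≡⟨ ℕP.+-comm _ 1 ⟩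
    suc (degree F X v)          ∎
    where
    open ℕP.≤-Reasoning
    I = incident F v
    split : (X ∪ ⁅ h ⁆) ∩ I ⊆ (X ∩ I) ∪ ⁅ h ⁆
    split x∈ = let x∈X∪h , x∈I = x∈p∩q⁻ (X ∪ ⁅ h ⁆) I x∈ in
      [ (λ x∈X → p⊆p∪q ⁅ h ⁆ (x∈p∩q⁺ (x∈X , x∈I))) , q⊆p∪q (X ∩ I) ⁅ h ⁆ ]′ (x∈p∪q⁻ X ⁅ h ⁆ x∈X∪h)

  degree-< : ∀ {X Y g v} → X ⊆ Y → g ∈ Y → Incident g v → g ∉ X → degree F X v < degree F Y v
  degree-< {X} {g = g} X⊆Y g∈Y g-at-v g∉X = p⊂q⇒∣p∣<∣q∣
    ( (λ x∈ → let x∈X , x∈I = x∈p∩q⁻ X _ x∈ in x∈p∩q⁺ (X⊆Y x∈X , x∈I))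
    , g , x∈p∩q⁺ (g∈Y , from ∈-incident⇔ g-at-v) , g∉X ∘ proj₁ ∘ x∈p∩q⁻ X _ )

  degree-⊥ : ∀ v → degree F ⊥ v ≡ 0
  degree-⊥ v = trans (cong ∣_∣ (∩-zeroˡ (incident F v))) (∣⊥∣≡0 m)

  walk-snoc : ∀ {u b x h es} → Walk F u b es → Joins F h b x → Walk F u x (es ++ [ h ])
  walk-snoc nil       joins = cons joins nil
  walk-snoc (cons j w) joins = cons j (walk-snoc w joins)

  unique-snoc : ∀ {h : Fin m} {es} → Unique es → h ∉ₗ es → Unique (es ++ [ h ])
  unique-snoc unique h∉es = ++⁺ unique (All.[] AllPairs.∷ AllPairs.[]) λ { (h∈es , Any.here refl) → h∉es h∈es }

  OnlyEdgeAt : (Fin m → Set) → Fin n → Fin m → Set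
  OnlyEdgeAt Q v e = Q e × Incident e v × (∀ h → Q h → Incident h v → h ≡ e)

  module _ {Q : Fin m → Set} (Q? : Decidable Q) where

    onlyEdgeAt? : ∀ v e → Dec (OnlyEdgeAt Q v e)
    onlyEdgeAt? v e = Q? e ×-dec incident? e v ×-dec all? (λ h → Q? h →-dec (incident? h v →-dec (h ≟ e)))

    another-edge-at : ∀ {v e} → Q e → Incident e v → ¬ OnlyEdgeAt Q v e →
                      ∃ λ h → Q h × Incident h v × h ≢ e
    another-edge-at {v} {e} Qe e-at-v notOnly with any? (λ h → Q? h ×-dec incident? h v ×-dec ¬? (h ≟ e))
    ... | yes found = found
    ... | no ∄h     = ⊥-elim (notOnly (Qe , e-at-v , λ h Qh h-at-v →
                        decidable-stable (h ≟ e) λ h≢e → ∄h (h , Qh , h-at-v , h≢e)))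

  Branching : (Fin m → Set) → Set
  Branching Q = ∀ v e → Q e → Incident e v → ∃ λ h → Q h × Incident h v × h ≢ e

  module _ {Q : Fin m → Set} where

    -- If Q branches, the path can leave
    -- b by an unused edge; in a forest that edge leads to an unvisited vertex, so fuel, which
    -- bounds the number of vertices still unvisited, eventually runs out.
    record PathInto (b : Fin n) (fuel : ℕ) : Set where
      field
        visited           : Subset n
        used              : List (Fin m)
        last              : Fin m
        last∈Q            : Q last
        last-at-b         : Incident last b
        b-visited         : b ∈ visited
        used-ends-visited : ∀ {e v} → e ∈ₗ used → Incident e v → v ∈ visited
        used-at-b         : ∀ {e} → e ∈ₗ used → Incident e b → e ≡ last
        trail-to-b        : ∀ {y} → y ∈ visited → ∃ λ es → Walk F y b es × Unique es × es ⊆ₗ used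
        room              : n < ∣ visited ∣ + fuel

    open PathInto

    start : ∀ {e} → Q e → PathInto (proj₁ (ends F e)) n
    start {e} Qe = record
      { visited           = ⁅ b ⁆
      ; used              = []
      ; last              = e
      ; last∈Q            = Qe
      ; last-at-b         = inj₁ refl
      ; b-visited         = x∈⁅x⁆ b
      ; used-ends-visited = λ ()
      ; used-at-b         = λ ()
      ; trail-to-b        = λ y∈⁅b⁆ → subst (λ y → ∃ λ es → Walk F y b es × Unique es × es ⊆ₗ [])
                                            (sym (x∈⁅y⁆⇒x≡y b y∈⁅b⁆)) ([] , nil , AllPairs.[] , λ ())
      ; room              = subst (λ c → n < c + n) (sym (∣⁅x⁆∣≡1 b)) ℕP.≤-refl
      }
      where
      b = proj₁ (ends F e)

    fresh-edge : ∀ {b k h} (P : PathInto b k) → Incident h b → h ≢ last P → h ∉ₗ used P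
    fresh-edge P h-at-b h≢last h∈used = h≢last (used-at-b P h∈used h-at-b)

    fresh-end : IsForest F → ∀ {b k h x} (P : PathInto b k) → Joins F h b x → h ∉ₗ used P → x ∉ visited P
    fresh-end forest {h = h} P joins h∉used x∈visited =
      let es , walk , unique , es⊆used = trail-to-b P x∈visited
          closed = forest _ (es ++ [ h ]) (walk-snoc walk joins) (unique-snoc unique (h∉used ∘ es⊆used))
      in contradiction (++-conicalʳ es [ h ] closed) λ ()

    grow : ∀ {b k h x} (P : PathInto b (suc k)) → Q h → Joins F h b x → h ∉ₗ used P → x ∉ visited P →
           PathInto x k
    grow {b} {k} {h} {x} P Qh joins h∉used x-new = record
      { visited           = visited P ∪ ⁅ x ⁆
      ; used              = h ∷ used P
      ; last              = h
      ; last∈Q            = Qh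
      ; last-at-b         = joins⇒incidentʳ joins
      ; b-visited         = q⊆p∪q _ _ (x∈⁅x⁆ x)
      ; used-ends-visited = ends-visited
      ; used-at-b         = at-x
      ; trail-to-b        = trail
      ; room              = room′
      }
      where
      ends-visited : ∀ {e v} → e ∈ₗ h ∷ used P → Incident e v → v ∈ visited P ∪ ⁅ x ⁆
      ends-visited (Any.here refl) e-at-v =
        [ (λ { refl → p⊆p∪q _ (b-visited P) }) , (λ { refl → q⊆p∪q _ _ (x∈⁅x⁆ x) }) ]′
          (joins-incident joins e-at-v)
      ends-visited (Any.there e∈) e-at-v = p⊆p∪q _ (used-ends-visited P e∈ e-at-v)
      at-x : ∀ {e} → e ∈ₗ h ∷ used P → Incident e x → e ≡ h
      at-x (Any.here refl) _      = refl
      at-x (Any.there e∈)  e-at-x = contradiction (used-ends-visited P e∈ e-at-x) x-new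
      trail : ∀ {y} → y ∈ visited P ∪ ⁅ x ⁆ → ∃ λ es → Walk F y x es × Unique es × es ⊆ₗ h ∷ used P
      trail {y} y∈ with x∈p∪q⁻ (visited P) ⁅ x ⁆ y∈
      ... | inj₁ y-visited =
        let es , walk , unique , es⊆used = trail-to-b P y-visited in
        es ++ [ h ] , walk-snoc walk joins , unique-snoc unique (h∉used ∘ es⊆used) ,
        λ z∈ → [ Any.there ∘ es⊆used , (λ { (Any.here refl) → Any.here refl }) ]′ (∈-++⁻ es z∈)
      ... | inj₂ y∈⁅x⁆ rewrite x∈⁅y⁆⇒x≡y x y∈⁅x⁆ = [] , nil , AllPairs.[] , λ ()
      room′ : n < ∣ visited P ∪ ⁅ x ⁆ ∣ + k
      room′ = begin-strict
        n                           <⟨ room P ⟩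
        ∣ visited P ∣ + suc k       ≡⟨ ℕP.+-suc _ k ⟩
        suc ∣ visited P ∣ + k       ≤⟨ ℕP.+-monoˡ-≤ k (p⊂q⇒∣p∣<∣q∣ visited⊂) ⟩
        ∣ visited P ∪ ⁅ x ⁆ ∣ + k   ∎
        where
        open ℕP.≤-Reasoning
        visited⊂ : visited P ⊂ visited P ∪ ⁅ x ⁆
        visited⊂ = p⊆p∪q _ , x , q⊆p∪q _ _ (x∈⁅x⁆ x) , x-new

    branching-impossible : IsForest F → Branching Q → ∀ k {b} → ¬ PathInto b k
    branching-impossible _ _ zero P = ℕP.<⇒≱ (subst (n <_) (ℕP.+-identityʳ _) (room P)) (∣p∣≤n (visited P))
    branching-impossible forest branching (suc k) {b} P with branching b (last P) (last∈Q P) (last-at-b P)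
    ... | h , Qh , h-at-b , h≢last with incident⇒joins h-at-b
    ... | x , joins =
      branching-impossible forest branching k (grow P Qh joins h∉used (fresh-end forest P joins h∉used))
      where
      h∉used = fresh-edge P h-at-b h≢last

  forest-onlyEdgeAt : IsForest F → {Q : Fin m → Set} → Decidable Q → ∀ {e} → Q e →
                      ∃ λ v → ∃ λ e → OnlyEdgeAt Q v e
  forest-onlyEdgeAt forest Q? Qe with any? (λ v → any? (onlyEdgeAt? Q? v))
  ... | yes found = found
  ... | no none = ⊥-elim (branching-impossible forest
                    (λ v e Qe e-at-v → another-edge-at Q? Qe e-at-v λ only → none (v , e , only))
                    n (start Qe))

  module _ (A : Subset m) where

    IsLeaf : Fin n → Set
    IsLeaf v = ∃ (OnlyEdgeAt (_∈ A) v)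

    isLeaf? : ∀ v → Dec (IsLeaf v)
    isLeaf? v = any? (onlyEdgeAt? (_∈? A) v)

    PendantAt : Fin n → Fin m → Set
    PendantAt w h = ∃ λ y → Joins F h w y × OnlyEdgeAt (_∈ A) y h

    pendant∈A : ∀ {w h} → PendantAt w h → h ∈ A
    pendant∈A (_ , _ , h∈A , _) = h∈A

    IsInner : Fin m → Set
    IsInner h = h ∈ A × ¬ IsLeaf (proj₁ (ends F h)) × ¬ IsLeaf (proj₂ (ends F h))

    isInner? : ∀ h → Dec (IsInner h)
    isInner? h = (h ∈? A) ×-dec ¬? (isLeaf? _) ×-dec ¬? (isLeaf? _)

    leaf-end⇒pendant : ∀ {h w y} → h ∈ A → Joins F h w y → IsLeaf y → PendantAt w h
    leaf-end⇒pendant {h} {y = y} h∈A joins (_ , _ , _ , only) =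
      y , joins , h∈A , h-at-y , λ h′ h′∈A h′-at-y → trans (only h′ h′∈A h′-at-y) (sym (only h h∈A h-at-y))
      where
      h-at-y = joins⇒incidentʳ joins

    outer⇒pendant : ∀ {h w} → h ∈ A → Incident h w → ¬ IsLeaf w → ¬ IsInner h → PendantAt w h
    outer⇒pendant {h} h∈A (inj₁ refl) w-nonleaf outer with isLeaf? (proj₂ (ends F h))
    ... | yes leaf    = leaf-end⇒pendant h∈A (inj₁ refl) leaf
    ... | no  nonleaf = contradiction (h∈A , w-nonleaf , nonleaf) outer
    outer⇒pendant {h} h∈A (inj₂ refl) w-nonleaf outer with isLeaf? (proj₁ (ends F h))
    ... | yes leaf    = leaf-end⇒pendant h∈A (inj₂ refl) leaf
    ... | no  nonleaf = contradiction (h∈A , nonleaf , w-nonleaf) outer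

    record PendantStar : Set where
      field
        centre            : Fin n
        stem              : Fin m
        stem∈A            : stem ∈ A
        stem-at-centre    : Incident stem centre
        pendant           : Fin m
        pendant-at-centre : PendantAt centre pendant
        others-pendant    : ∀ {h} → h ∈ A → Incident h centre → h ≢ stem → PendantAt centre h

    pendantStar-fromPendant : (∀ h → ¬ IsInner h) → ∀ {e w y} → e ∈ A → Joins F e w y → IsLeaf y → PendantStar
    pendantStar-fromPendant noInner {e} {w} e∈A joins y-leaf = record
      { centre            = w
      ; stem              = e
      ; stem∈A            = e∈A
      ; stem-at-centre    = joins⇒incidentˡ joins
      ; pendant           = e
      ; pendant-at-centre = leaf-end⇒pendant e∈A joins y-leaf
      ; others-pendant    = others
      }
      where
      others : ∀ {h} → h ∈ A → Incident h w → h ≢ e → PendantAt w h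
      others h∈A h-at-w h≢e with isLeaf? w
      ... | yes (_ , _ , _ , only) =
        contradiction (trans (only _ h∈A h-at-w) (sym (only e e∈A (joins⇒incidentˡ joins)))) h≢e
      ... | no  w-nonleaf            = outer⇒pendant h∈A h-at-w w-nonleaf (noInner _)

    pendantStar-innerLeaf : ∀ {w g} → OnlyEdgeAt IsInner w g → PendantStar
    pendantStar-innerLeaf {w} {g} ((g∈A , end₁-nonleaf , end₂-nonleaf) , g-at-w , only) = record
      { centre            = w
      ; stem              = g
      ; stem∈A            = g∈A
      ; stem-at-centre    = g-at-w
      ; pendant           = proj₁ another
      ; pendant-at-centre = let _ , e∈A , e-at-w , e≢g = another in others e∈A e-at-w e≢g
      ; others-pendant    = others
      }
      where
      w-nonleaf : ¬ IsLeaf w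
      w-nonleaf w-leaf =
        [ (λ w≡ → end₁-nonleaf (subst IsLeaf w≡ w-leaf)) , (λ w≡ → end₂-nonleaf (subst IsLeaf w≡ w-leaf)) ]′ g-at-w
      others : ∀ {h} → h ∈ A → Incident h w → h ≢ g → PendantAt w h
      others h∈A h-at-w h≢g = outer⇒pendant h∈A h-at-w w-nonleaf λ h-inner → h≢g (only _ h-inner h-at-w)
      another : ∃ λ e → e ∈ A × Incident e w × e ≢ g
      another = another-edge-at (_∈? A) g∈A g-at-w (w-nonleaf ∘ (g ,_))

    pendantStar-noInner : (∀ h → ¬ IsInner h) → ∀ {e₀} → e₀ ∈ A → PendantStar
    pendantStar-noInner noInner {e₀} e₀∈A with isLeaf? (proj₁ (ends F e₀)) | isLeaf? (proj₂ (ends F e₀))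
    ... | yes leaf₁  | _         = pendantStar-fromPendant noInner e₀∈A (inj₂ refl) leaf₁
    ... | no  _      | yes leaf₂ = pendantStar-fromPendant noInner e₀∈A (inj₁ refl) leaf₂
    ... | no  inner₁ | no inner₂ = contradiction (e₀∈A , inner₁ , inner₂) (noInner e₀)

    -- Either every edge of A has a leaf end, or the inner edges form a nonempty forest. A leaf
    -- of the latter carries one inner edge, and it has a further A-edge, which is pendant.
    pendantStar : IsForest F → ∀ {e₀} → e₀ ∈ A → PendantStar
    pendantStar forest e₀∈A with any? isInner?
    ... | yes (_ , inner) =
      let _ , _ , only = forest-onlyEdgeAt forest isInner? inner in pendantStar-innerLeaf only
    ... | no  ∄inner      = pendantStar-noInner (λ h inner → ∄inner (h , inner)) e₀∈A

  module _ (lam : Fin n → ℕ) where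

    BD? : ∀ σ → Dec (BD F lam σ)
    BD? σ = all? λ v → degree F σ v ≤? lam v

    BD-⊥ : BD F lam ⊥
    BD-⊥ v = subst (_≤ lam v) (sym (degree-⊥ v)) z≤n

    BD-downClosed : DownClosed (BD F lam)
    BD-downClosed τ⊆σ bounded v = ℕP.≤-trans (degree-mono τ⊆σ v) (bounded v)

    -- B collects the edges fixed by passing to links; BD F lam is BDWithin ⊤ ⊥.
    BDWithin : Subset m → Subset m → Complex m
    BDWithin A B σ = σ ⊆ A × BD F lam (σ ∪ B)

    BDWithin-⊤-⊥ : BDWithin ⊤ ⊥ ≃ BD F lam
    BDWithin-⊤-⊥ σ = mk⇔ (λ (_ , bounded) → subst (BD F lam) (∪-identityʳ σ) bounded)
                         (λ bounded → (λ {_} → ⊆⊤) , subst (BD F lam) (sym (∪-identityʳ σ)) bounded)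

    BDWithin-downClosed : ∀ {A B} → DownClosed (BDWithin A B)
    BDWithin-downClosed {B = B} τ⊆σ (σ⊆A , bounded) =
      σ⊆A ∘ τ⊆σ , BD-downClosed (∪-monoˡ-⊆ B τ⊆σ) bounded

    BDWithin-empty : ∀ {A B} → ¬ Nonempty A → BD F lam B → IsSimplex (BDWithin A B)
    BDWithin-empty {A} {B} empty B-bounded = A , λ σ → mk⇔ {B = σ ⊆ A} proj₁ λ σ⊆A →
      σ⊆A , BD-downClosed (∪-least (λ x∈σ → ⊥-elim (empty (_ , σ⊆A x∈σ))) ⊆-refl) B-bounded

    BDWithin-del : ∀ {A B e} → del e (BDWithin A B) ≃ BDWithin (A - e) B
    BDWithin-del σ = mk⇔ (λ (e∉σ , σ⊆A , bounded) → p⊆q∧x∉p⇒p⊆q-x σ⊆A e∉σ , bounded)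
                         (λ (σ⊆A-e , bounded) → x∉p-x ∘ σ⊆A-e , x∈p-y⇒x∈p ∘ σ⊆A-e , bounded)

    BDWithin-lk : ∀ {A B e} → e ∈ A → lk e (BDWithin A B) ≃ BDWithin (A - e) (B ∪ ⁅ e ⁆)
    BDWithin-lk {A} {B} {e} e∈A σ = mk⇔
      (λ (e∉σ , σ∪e⊆A , bounded) → p⊆q∧x∉p⇒p⊆q-x (σ∪e⊆A ∘ p⊆p∪q _) e∉σ , subst (BD F lam) regroup bounded)
      (λ (σ⊆A-e , bounded) → x∉p-x ∘ σ⊆A-e , ∪-least (x∈p-y⇒x∈p ∘ σ⊆A-e) (x∈p⇒⁅x⁆⊆p e∈A) ,
                              subst (BD F lam) (sym regroup) bounded)
      where
      regroup : (σ ∪ ⁅ e ⁆) ∪ B ≡ σ ∪ (B ∪ ⁅ e ⁆)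
      regroup = trans (∪-swapʳ σ ⁅ e ⁆ B) (∪-assoc σ B ⁅ e ⁆)

    add-pendant : ∀ {A B σ h w} → PendantAt A w h → BDWithin A B ⁅ h ⁆ → BDWithin A B σ →
                  degree F ((σ ∪ ⁅ h ⁆) ∪ B) w ≤ lam w → BD F lam ((σ ∪ ⁅ h ⁆) ∪ B)
    add-pendant {A} {B} {σ} {h} {w} (y , joins , _ , _ , only-h) (_ , h-bounded) (σ⊆A , σ-bounded) w-bounded v
      with v ≟ w
    ... | yes refl = w-bounded
    ... | no v≢w with incident? h v
    ...   | no h-not-at-v = ℕP.≤-trans (degree-mono-at avoid-h) (σ-bounded v)
      where
      avoid-h : ∀ {x} → x ∈ (σ ∪ ⁅ h ⁆) ∪ B → Incident x v → x ∈ σ ∪ B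
      avoid-h x∈ x-at-v with x∈p∪q⁻ (σ ∪ ⁅ h ⁆) B x∈
      ... | inj₂ x∈B = q⊆p∪q σ B x∈B
      ... | inj₁ x∈σ∪h with x∈p∪q⁻ σ ⁅ h ⁆ x∈σ∪h
      ...   | inj₁ x∈σ = p⊆p∪q B x∈σ
      ...   | inj₂ x∈h = contradiction (subst (λ z → Incident z v) (x∈⁅y⁆⇒x≡y h x∈h) x-at-v) h-not-at-v
    ...   | yes h-at-v with joins-incident joins h-at-v
    ...     | inj₁ v≡w  = contradiction v≡w v≢w
    ...     | inj₂ refl = ℕP.≤-trans (degree-mono-at only-h-at-y) (h-bounded y)
      where
      only-h-at-y : ∀ {x} → x ∈ (σ ∪ ⁅ h ⁆) ∪ B → Incident x y → x ∈ ⁅ h ⁆ ∪ B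
      only-h-at-y x∈ x-at-y with x∈p∪q⁻ (σ ∪ ⁅ h ⁆) B x∈
      ... | inj₂ x∈B = q⊆p∪q ⁅ h ⁆ B x∈B
      ... | inj₁ x∈σ∪h with x∈p∪q⁻ σ ⁅ h ⁆ x∈σ∪h
      ...   | inj₁ x∈σ = p⊆p∪q B (subst (_∈ ⁅ h ⁆) (sym (only-h _ (σ⊆A x∈σ) x-at-y)) (x∈⁅x⁆ h))
      ...   | inj₂ x∈h = p⊆p∪q B x∈h

    BDWithin-coneApex : ∀ {A B e w} → PendantAt A w e → BDWithin A B ⁅ e ⁆ → degree F (A ∪ B) w ≤ lam w →
                        IsConeApex e (BDWithin A B)
    BDWithin-coneApex {A} {B} {w = w} pendant@(_ , _ , e∈A , _) e-face A-fits-at-w face@(σ⊆A , _) =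
      σ∪e⊆A , add-pendant pendant e-face face (ℕP.≤-trans (degree-mono (∪-monoˡ-⊆ B σ∪e⊆A) w) A-fits-at-w)
      where
      σ∪e⊆A = ∪-least σ⊆A (x∈p⇒⁅x⁆⊆p e∈A)

    VDWithin : Subset m → Set₁
    VDWithin A = ∀ {B} → (∀ {x} → x ∈ A → x ∉ B) → BD F lam B → VertexDecomposable (BDWithin A B)

    module _ {A B : Subset m} (star : PendantStar A) where
      open PendantStar star

      BDWithin-shedding : stem ∉ B → (∀ {h} → h ∈ A → BDWithin A B ⁅ h ⁆) →
                          lam centre < degree F (A ∪ B) centre →
                          ∀ σ → IsFacet (del stem (BDWithin A B)) σ → IsFacet (BDWithin A B) σ
      BDWithin-shedding stem∉B vertex overfull σ ((stem∉σ , face@(σ⊆A , _)) , maximal) = face , maximal′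
        where
        w = centre
        g = stem

        extend : ∀ {h} → h ∈ A → Incident h w → h ≢ g → degree F (σ ∪ B) w < lam w →
                 del g (BDWithin A B) (σ ∪ ⁅ h ⁆)
        extend {h} h∈A h-at-w h≢g unsat =
          x∉p∪q stem∉σ (x≢y⇒x∉⁅y⁆ (h≢g ∘ sym)) , ∪-least σ⊆A (x∈p⇒⁅x⁆⊆p h∈A) ,
          add-pendant (others-pendant h∈A h-at-w h≢g) (vertex h∈A) face fits-at-w
          where
          open ℕP.≤-Reasoning
          fits-at-w : degree F ((σ ∪ ⁅ h ⁆) ∪ B) w ≤ lam w
          fits-at-w = begin
            degree F ((σ ∪ ⁅ h ⁆) ∪ B) w  ≡⟨ cong (λ X → degree F X w) (∪-swapʳ σ ⁅ h ⁆ B) ⟩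
            degree F ((σ ∪ B) ∪ ⁅ h ⁆) w  ≤⟨ degree-∪⁅⁆ (σ ∪ B) h w ⟩
            suc (degree F (σ ∪ B) w)      ≤⟨ unsat ⟩
            lam w                         ∎

        Missing : Fin m → Set
        Missing h = h ∈ A × Incident h w × h ≢ g × h ∉ σ

        covered : ¬ ∃ Missing → ∀ {x} → x ∈ A ∪ B → Incident x w → x ∈ (σ ∪ B) ∪ ⁅ g ⁆
        covered none {x} x∈A∪B x-at-w with x∈p∪q⁻ A B x∈A∪B | x ≟ g | x ∈? σ
        ... | inj₂ x∈B | _        | _        = p⊆p∪q ⁅ g ⁆ (q⊆p∪q σ B x∈B)
        ... | inj₁ _   | yes refl | _        = q⊆p∪q (σ ∪ B) ⁅ g ⁆ (x∈⁅x⁆ g)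
        ... | inj₁ _   | no _     | yes x∈σ = p⊆p∪q ⁅ g ⁆ (p⊆p∪q B x∈σ)
        ... | inj₁ x∈A | no x≢g   | no x∉σ  = contradiction (x , x∈A , x-at-w , x≢g , x∉σ) none

        missing? : ∀ h → Dec (Missing h)
        missing? h = (h ∈? A) ×-dec incident? h w ×-dec ¬? (h ≟ g) ×-dec ¬? (h ∈? σ)

        -- With room left at w, either a missing pendant edge would extend σ, or σ would hold
        -- every A-edge at w but g, so that all of A ∪ B would fit at w.
        saturated : ¬ degree F (σ ∪ B) w < lam w
        saturated unsat with any? missing?
        ... | yes (h , h∈A , h-at-w , h≢g , h∉σ) =
          h∉σ (maximal (σ ∪ ⁅ h ⁆) (extend h∈A h-at-w h≢g unsat) (p⊆p∪q _) (q⊆p∪q σ _ (x∈⁅x⁆ h)))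
        ... | no none = ℕP.<⇒≱ overfull
          (ℕP.≤-trans (degree-mono-at (covered none)) (ℕP.≤-trans (degree-∪⁅⁆ (σ ∪ B) g w) unsat))

        maximal′ : ∀ τ → BDWithin A B τ → σ ⊆ τ → τ ⊆ σ
        maximal′ τ τ-face σ⊆τ with g ∈? τ
        ... | no  g∉τ = maximal τ (g∉τ , τ-face) σ⊆τ
        ... | yes g∈τ = ⊥-elim (saturated (ℕP.<-≤-trans
              (degree-< (∪-monoˡ-⊆ B σ⊆τ) (p⊆p∪q B g∈τ) stem-at-centre (x∉p∪q stem∉σ stem∉B))
              (proj₂ τ-face w)))

      BDWithin-fromStar : (∀ {x} → x ∈ A → x ∉ B) → BD F lam B → (∀ {h} → h ∈ A → BDWithin A B ⁅ h ⁆) →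
                          (∀ {e} → e ∈ A → VDWithin (A - e)) → VertexDecomposable (BDWithin A B)
      BDWithin-fromStar disjoint B-bounded vertex IH with degree F (A ∪ B) centre ≤? lam centre
      ... | yes fits =
        cone-vertexDecomposable BDWithin-downClosed (BDWithin-coneApex pendant-at-centre (vertex e∈A) fits)
          (≃-sym BDWithin-del) (IH e∈A (disjoint ∘ x∈p-y⇒x∈p) B-bounded)
        where
        e∈A = pendant∈A A pendant-at-centre
      ... | no overfull =
        shed stem (vertex stem∈A)
          (VertexDecomposable-resp-≃ (≃-sym (BDWithin-lk stem∈A)) (IH stem∈A disjoint-lk stem-bounded))
          (VertexDecomposable-resp-≃ (≃-sym BDWithin-del) (IH stem∈A (disjoint ∘ x∈p-y⇒x∈p) B-bounded))
          (BDWithin-shedding (disjoint stem∈A) vertex (ℕP.≰⇒> overfull))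
        where
        disjoint-lk : ∀ {x} → x ∈ A - stem → x ∉ B ∪ ⁅ stem ⁆
        disjoint-lk x∈ = x∉p∪q (disjoint (x∈p-y⇒x∈p x∈)) (x≢y⇒x∉⁅y⁆ (x∈p-y⇒x≢y x∈))
        stem-bounded : BD F lam (B ∪ ⁅ stem ⁆)
        stem-bounded = subst (BD F lam) (∪-comm ⁅ stem ⁆ B) (proj₂ (vertex stem∈A))

    BDWithin-step : IsForest F → ∀ {A e₀} → e₀ ∈ A → (∀ {e} → e ∈ A → VDWithin (A - e)) → VDWithin A
    BDWithin-step forest {A} e₀∈A IH {B} disjoint B-bounded
      with any? (λ e → (e ∈? A) ×-dec ¬? (BD? (⁅ e ⁆ ∪ B)))
    ... | yes (e , e∈A , e-too-big) =
      VertexDecomposable-resp-≃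
        (≃-sym (≃-trans (nonVertex-del BDWithin-downClosed (e-too-big ∘ proj₂)) BDWithin-del))
        (IH e∈A (disjoint ∘ x∈p-y⇒x∈p) B-bounded)
    ... | no allVertices = BDWithin-fromStar (pendantStar A forest e₀∈A) disjoint B-bounded vertex IH
      where
      vertex : ∀ {h} → h ∈ A → BDWithin A B ⁅ h ⁆
      vertex {h} h∈A =
        x∈p⇒⁅x⁆⊆p h∈A , decidable-stable (BD? (⁅ h ⁆ ∪ B)) λ too-big → allVertices (_ , h∈A , too-big)

    BDWithin-vertexDecomposable : IsForest F → ∀ k {A} → ∣ A ∣ ≤ k → VDWithin A
    BDWithin-vertexDecomposable forest k {A} size disjoint B-bounded with nonempty? A
    ... | no empty = simplex (BDWithin-empty empty B-bounded)
    BDWithin-vertexDecomposable forest zero size _ _ | yes (_ , e∈A) =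
      ⊥-elim (ℕP.n≮0 (ℕP.<-≤-trans (x∈p⇒∣p-x∣<∣p∣ e∈A) size))
    BDWithin-vertexDecomposable forest (suc k) size disjoint B-bounded | yes (_ , e₀∈A) =
      BDWithin-step forest e₀∈A
        (λ e∈A → BDWithin-vertexDecomposable forest k (ℕP.≤-pred (ℕP.<-≤-trans (x∈p⇒∣p-x∣<∣p∣ e∈A) size)))
        disjoint B-bounded

theorem3p1 : ∀ (n m : ℕ) (F : SimpleGraph n m) → IsForest F →
               (lam : Fin n → ℕ) → VertexDecomposable (BD F lam)
theorem3p1 n m F forest lam =
  VertexDecomposable-resp-≃ (BDWithin-⊤-⊥ F lam)
    (BDWithin-vertexDecomposable F lam forest m (∣p∣≤n ⊤) (λ _ → ∉⊥) (BD-⊥ F lam))
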